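{- Let $d\in\{ -43,-19,-11,-3,3,5,7,11,13,19,23\}$, $K=\mathbb{Q}(\sqrt d)$, $r\ge1$ an integer and $p$ a prime. Let $(a,b,c)\in\mathcal{O}_K^3$ be a non-trivial solution of $d^ra^p+b^p+c^p=0$ such that $(da,b,c)$ is primitive, and let $E$ be the elliptic curve $y^2=x(x-d^ra^p)(x+b^p)$ over $K$. Then $E$ is semistable at every prime of $K$ above $d$.
   Context: Non-trivial means $abc\ne0$; primitive means pairwise coprime in $\mathcal{O}_K$. -}

module Defs where

open import Data.Nat using (ℕ; zero; suc)
open import Data.Integer using (ℤ; +_; -[1+_])
open import Data.Rational using (ℚ; _/_; 0ℚ; 1ℚ)
import Data.Rational as Q
open import Data.Product using (_×_; _,_; Σ; ∃; ∃-syntax)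
open import Data.Sum using (_⊎_)
open import Data.List using (List; _∷_; [])
open import Data.List.Membership.Propositional using (_∈_)
open import Relation.Binary.PropositionalEquality using (_≡_)
open import Relation.Nullary using (¬_)

allowedD : List ℤ
allowedD = -[1+ 42 ] ∷ -[1+ 18 ] ∷ -[1+ 10 ] ∷ -[1+ 2 ]
         ∷ + 3 ∷ + 5 ∷ + 7 ∷ + 11 ∷ + 13 ∷ + 19 ∷ + 23 ∷ []

-- The quadratic field K = ℚ(√d): the pair (x , y) stands for x + y√d.
-- Every operation is parametrised by the integer d.

K : Set
K = ℚ × ℚ

ℤ→ℚ : ℤ → ℚ
ℤ→ℚ n = n / 1

module Field (d : ℤ) where

  infixl 6 _+K_ _-K_
  infixl 7 _*K_
  infixr 8 _^K_

  ofℤ : ℤ → K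
  ofℤ n = (ℤ→ℚ n , 0ℚ)

  0K 1K : K
  0K = (0ℚ , 0ℚ)
  1K = (1ℚ , 0ℚ)

  _+K_ : K → K → K
  (a , b) +K (c , e) = (a Q.+ c , b Q.+ e)

  -K_ : K → K
  -K (a , b) = (Q.- a , Q.- b)

  _-K_ : K → K → K
  x -K y = x +K (-K y)

  _*K_ : K → K → K
  (a , b) *K (c , e) = (a Q.* c Q.+ ℤ→ℚ d Q.* (b Q.* e) , a Q.* e Q.+ b Q.* c)

  _^K_ : K → ℕ → K
  x ^K zero    = 1K
  x ^K (suc n) = x *K (x ^K n)

  k : ℕ → K
  k n = ofℤ (+ n)

  Isℤ : ℚ → Set
  Isℤ q = ∃[ n ] q ≡ ℤ→ℚ n

  trace norm : K → ℚ
  trace (x , y) = ℤ→ℚ (+ 2) Q.* x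
  norm  (x , y) = x Q.* x Q.- ℤ→ℚ d Q.* (y Q.* y)

  -- z ∈ 𝒪_K: z is an algebraic integer, i.e. the coefficients of its
  -- characteristic polynomial X² - Tr(z) X + N(z) are rational integers.
  Integral : K → Set
  Integral z = Isℤ (trace z) × Isℤ (norm z)

  Coprime : K → K → Set
  Coprime α β = ∃[ x ] ∃[ y ] Integral x × Integral y × (x *K α +K y *K β ≡ 1K)

  Primitive : K → K → K → Set
  Primitive α β γ = Coprime α β × Coprime α γ × Coprime β γ

  record PrimeIdeal (𝔭 : K → Set) : Set where
    field
      sub   : ∀ z → 𝔭 z → Integral z
      zero∈ : 𝔭 0K
      +-closed : ∀ x y → 𝔭 x → 𝔭 y → 𝔭 (x +K y)
      *-closed : ∀ r x → Integral r → 𝔭 x → 𝔭 (r *K x)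
      proper   : ¬ 𝔭 1K
      prime    : ∀ x y → Integral x → Integral y → 𝔭 (x *K y) → 𝔭 x ⊎ 𝔭 y

  -- x lies in the local ring 𝒪_{K,𝔭}: x = t / s with t, s ∈ 𝒪_K, s ∉ 𝔭.
  Integralᵖ : (K → Set) → K → Set
  Integralᵖ 𝔭 x = ∃[ s ] Integral s × ¬ 𝔭 s × Integral (s *K x)

  -- x is a unit of 𝒪_{K,𝔭}: x = t / s with t, s ∈ 𝒪_K \ 𝔭.
  Unitᵖ : (K → Set) → K → Set
  Unitᵖ 𝔭 x = ∃[ s ] Integral s × ¬ 𝔭 s × Integral (s *K x) × ¬ 𝔭 (s *K x)

  -- Weierstrass equations y² + a1 xy + a3 y = x³ + a2 x² + a4 x + a6

  record Weierstrass : Set where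
    constructor W
    field a1 a2 a3 a4 a6 : K

  module Inv (E : Weierstrass) where
    open Weierstrass E
    b2 b4 b6 b8 c4 Δ : K
    b2 = a1 *K a1 +K k 4 *K a2
    b4 = k 2 *K a4 +K a1 *K a3
    b6 = a3 *K a3 +K k 4 *K a6
    b8 = a1 *K a1 *K a6 +K k 4 *K a2 *K a6 -K a1 *K a3 *K a4
         +K a2 *K a3 *K a3 -K a4 *K a4
    c4 = b2 *K b2 -K k 24 *K b4
    Δ  = -K (b2 *K b2 *K b8) -K k 8 *K b4 *K b4 *K b4
         -K k 27 *K b6 *K b6 +K k 9 *K b2 *K b4 *K b6

  -- E' is obtained from E by the change of variables
  -- x = u² x' + r, y = u³ y' + s u² x' + t  (u ≠ 0), all over K.
  Isomorphic : Weierstrass → Weierstrass → Set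
  Isomorphic E E' = ∃[ u ] ∃[ r ] ∃[ s ] ∃[ t ] ¬ (u ≡ 0K) ×
      (u *K a1' ≡ a1 +K k 2 *K s) ×
      (u ^K 2 *K a2' ≡ a2 -K s *K a1 +K k 3 *K r -K s *K s) ×
      (u ^K 3 *K a3' ≡ a3 +K r *K a1 +K k 2 *K t) ×
      (u ^K 4 *K a4' ≡ a4 -K s *K a3 +K k 2 *K r *K a2 -K (t +K r *K s) *K a1
                        +K k 3 *K r *K r -K k 2 *K s *K t) ×
      (u ^K 6 *K a6' ≡ a6 +K r *K a4 +K r *K r *K a2 +K r *K r *K r
                        -K t *K a3 -K t *K t -K r *K t *K a1)
    where
    open Weierstrass E
    open Weierstrass E' renaming (a1 to a1'; a2 to a2'; a3 to a3'; a4 to a4'; a6 to a6')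

  -- E has semistable (good or multiplicative) reduction at 𝔭: some model of E
  -- that is integral at 𝔭 has reduction mod 𝔭 which is either non-singular
  -- (Δ a 𝔭-unit) or has a node (Δ ∈ 𝔭, c4 a 𝔭-unit).
  SemistableAt : (K → Set) → Weierstrass → Set
  SemistableAt 𝔭 E = ∃[ E' ] Isomorphic E E' ×
      Integralᵖ 𝔭 (Weierstrass.a1 E') × Integralᵖ 𝔭 (Weierstrass.a2 E') ×
      Integralᵖ 𝔭 (Weierstrass.a3 E') × Integralᵖ 𝔭 (Weierstrass.a4 E') ×
      Integralᵖ 𝔭 (Weierstrass.a6 E') ×
      (Unitᵖ 𝔭 (Inv.Δ E') ⊎ Unitᵖ 𝔭 (Inv.c4 E'))

  -- The Frey curve y² = x (x - A)(x + B) = x³ + (B - A) x² - A B x.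
  Frey : K → K → Weierstrass
  Frey A B = W 0K (B -K A) 0K (-K (A *K B)) 0K

{-# OPTIONS --safe #-}
-- Use the Frey model itself.  Since 𝔭 ∣ d and r ≥ 1, 𝔭 divides A = dʳaᵖ, while
-- B = bᵖ is prime to 𝔭 because da and b are coprime.  Hence
-- c₄ = 16(A² + AB + B²) ≡ 16B² (mod 𝔭), and 2 ∉ 𝔭 because every admissible d is
-- odd, so c₄ is a 𝔭-unit: the reduction is good or multiplicative.  Integrality
-- of the model is checked on trace and norm; a sum y + x with x ∈ 𝔭 is handled
-- by N(y + x) = N y + N x + tr y · tr x − tr(y x), where y x ∈ 𝔭 ⊆ 𝒪_K.

module Submission where

open import Defs
open import Data.Nat using (ℕ; zero; suc; _≥_; s≤s)
open import Data.Nat.Primality using (Prime)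
open import Data.Integer as ℤ using (ℤ; +_; -[1+_])
open import Data.Integer.Properties using (*-identityʳ)
open import Data.Rational as ℚ using (ℚ; 0ℚ; toℚᵘ)
open import Data.Rational.Properties
  using (*-distribˡ-+; toℚᵘ-injective; toℚᵘ-fromℚᵘ; toℚᵘ-homo-+; toℚᵘ-homo-*; toℚᵘ-homo‿-; +-*-commutativeRing; 1≢0)
open import Data.Rational.Unnormalised as ℚᵘ using (mkℚᵘ; *≡*)
import Data.Rational.Unnormalised.Properties as ℚᵘ
open import Data.Product using (_×_; _,_; proj₁; proj₂; ∃-syntax)
open import Data.Sum using (inj₂; [_,_]′)
open import Data.List using (List; _∷_; [])
open import Data.List.Membership.Propositional using (_∈_)
import Data.List.Relation.Unary.All as All
open import Function using (id; _∘_)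
open import Data.Empty using (⊥-elim)
open import Relation.Binary.PropositionalEquality
open import Relation.Nullary using (¬_)
open import Relation.Nullary.Decidable using (dec⇒maybe)
open import Tactic.RingSolver using (solve; solve-∀)
open import Tactic.RingSolver.Core.AlmostCommutativeRing using (AlmostCommutativeRing; fromCommutativeRing)

ℚ-ring : AlmostCommutativeRing _ _
ℚ-ring = fromCommutativeRing +-*-commutativeRing (λ q → dec⇒maybe (0ℚ ℚ.≟ q))

p+q-q≡p : ∀ p q → p ℚ.+ q ℚ.- q ≡ p
p+q-q≡p = solve-∀ ℚ-ring

toℚᵘ-ℤ→ℚ : ∀ n → toℚᵘ (ℤ→ℚ n) ℚᵘ.≃ mkℚᵘ n 0
toℚᵘ-ℤ→ℚ n = toℚᵘ-fromℚᵘ (mkℚᵘ n 0)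

ℤ→ℚ-+ : ∀ m n → ℤ→ℚ (m ℤ.+ n) ≡ ℤ→ℚ m ℚ.+ ℤ→ℚ n
ℤ→ℚ-+ m n = toℚᵘ-injective (begin
  toℚᵘ (ℤ→ℚ (m ℤ.+ n))           ≈⟨ toℚᵘ-ℤ→ℚ (m ℤ.+ n) ⟩
  mkℚᵘ (m ℤ.+ n) 0               ≈⟨ *≡* (cong (ℤ._* + 1) (cong₂ ℤ._+_ (*-identityʳ m) (*-identityʳ n))) ⟨
  mkℚᵘ m 0 ℚᵘ.+ mkℚᵘ n 0         ≈⟨ ℚᵘ.+-cong (toℚᵘ-ℤ→ℚ m) (toℚᵘ-ℤ→ℚ n) ⟨
  toℚᵘ (ℤ→ℚ m) ℚᵘ.+ toℚᵘ (ℤ→ℚ n) ≈⟨ toℚᵘ-homo-+ (ℤ→ℚ m) (ℤ→ℚ n) ⟨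
  toℚᵘ (ℤ→ℚ m ℚ.+ ℤ→ℚ n)         ∎)
  where open ℚᵘ.≃-Reasoning

ℤ→ℚ-* : ∀ m n → ℤ→ℚ (m ℤ.* n) ≡ ℤ→ℚ m ℚ.* ℤ→ℚ n
ℤ→ℚ-* m n = toℚᵘ-injective (begin
  toℚᵘ (ℤ→ℚ (m ℤ.* n))           ≈⟨ toℚᵘ-ℤ→ℚ (m ℤ.* n) ⟩
  mkℚᵘ m 0 ℚᵘ.* mkℚᵘ n 0         ≈⟨ ℚᵘ.*-cong (toℚᵘ-ℤ→ℚ m) (toℚᵘ-ℤ→ℚ n) ⟨
  toℚᵘ (ℤ→ℚ m) ℚᵘ.* toℚᵘ (ℤ→ℚ n) ≈⟨ toℚᵘ-homo-* (ℤ→ℚ m) (ℤ→ℚ n) ⟨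
  toℚᵘ (ℤ→ℚ m ℚ.* ℤ→ℚ n)         ∎)
  where open ℚᵘ.≃-Reasoning

ℤ→ℚ-neg : ∀ n → ℤ→ℚ (ℤ.- n) ≡ ℚ.- ℤ→ℚ n
ℤ→ℚ-neg n = toℚᵘ-injective (begin
  toℚᵘ (ℤ→ℚ (ℤ.- n))   ≈⟨ toℚᵘ-ℤ→ℚ (ℤ.- n) ⟩
  ℚᵘ.- mkℚᵘ n 0        ≈⟨ ℚᵘ.-‿cong (toℚᵘ-ℤ→ℚ n) ⟨
  ℚᵘ.- toℚᵘ (ℤ→ℚ n)    ≈⟨ toℚᵘ-homo‿- (ℤ→ℚ n) ⟨
  toℚᵘ (ℚ.- ℤ→ℚ n)     ∎)
  where open ℚᵘ.≃-Reasoning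

allowedD-odd : All.All (λ d → ∃[ v ] d ℤ.+ v ℤ.* + 2 ≡ + 1) allowedD
allowedD-odd = (+ 22 , refl) All.∷ (+ 10 , refl) All.∷ (+ 6 , refl) All.∷ (+ 2 , refl)
  All.∷ (-[1+ 0 ] , refl) All.∷ (-[1+ 1 ] , refl) All.∷ (-[1+ 2 ] , refl) All.∷ (-[1+ 4 ] , refl)
  All.∷ (-[1+ 5 ] , refl) All.∷ (-[1+ 8 ] , refl) All.∷ (-[1+ 10 ] , refl) All.∷ All.[]

module QuadraticIntegers (d : ℤ) where
  open Field d

  Isℤ-+ : ∀ {p q} → Isℤ p → Isℤ q → Isℤ (p ℚ.+ q)
  Isℤ-+ (m , refl) (n , refl) = m ℤ.+ n , sym (ℤ→ℚ-+ m n)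

  Isℤ-* : ∀ {p q} → Isℤ p → Isℤ q → Isℤ (p ℚ.* q)
  Isℤ-* (m , refl) (n , refl) = m ℤ.* n , sym (ℤ→ℚ-* m n)

  Isℤ-sub : ∀ {p q} → Isℤ p → Isℤ q → Isℤ (p ℚ.- q)
  Isℤ-sub p∈ℤ (n , refl) = Isℤ-+ p∈ℤ (ℤ.- n , sym (ℤ→ℚ-neg n))

  -- The ring solver only abstracts variables, hence the `with ℤ→ℚ d` before each call.

  *K-comm : ∀ x y → x *K y ≡ y *K x
  *K-comm (a , b) (c , e) with ℤ→ℚ d
  ... | D = cong₂ _,_ (solve (a ∷ b ∷ c ∷ e ∷ D ∷ []) ℚ-ring) (solve (a ∷ b ∷ c ∷ e ∷ []) ℚ-ring)

  *K-identityˡ : ∀ x → 1K *K x ≡ x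
  *K-identityˡ (a , b) with ℤ→ℚ d
  ... | D = cong₂ _,_ (solve (a ∷ b ∷ D ∷ []) ℚ-ring) (solve (a ∷ b ∷ []) ℚ-ring)

  *K-identityʳ : ∀ x → x *K 1K ≡ x
  *K-identityʳ x = trans (*K-comm x 1K) (*K-identityˡ x)

  -1*Kx≡-Kx : ∀ x → ofℤ -[1+ 0 ] *K x ≡ -K x
  -1*Kx≡-Kx (a , b) with ℤ→ℚ d
  ... | D = cong₂ _,_ (solve (a ∷ b ∷ D ∷ []) ℚ-ring) (solve (a ∷ b ∷ []) ℚ-ring)

  x+Ky-Ky≡x : ∀ x y → x +K y -K y ≡ x
  x+Ky-Ky≡x (a , b) (c , e) = cong₂ _,_ (p+q-q≡p a c) (p+q-q≡p b e)

  ofℤ-+ : ∀ m n → ofℤ (m ℤ.+ n) ≡ ofℤ m +K ofℤ n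
  ofℤ-+ m n = cong (_, 0ℚ) (ℤ→ℚ-+ m n)

  ofℤ-* : ∀ m n → ofℤ (m ℤ.* n) ≡ ofℤ m *K ofℤ n
  ofℤ-* m n rewrite ℤ→ℚ-* m n with ℤ→ℚ m | ℤ→ℚ n | ℤ→ℚ d
  ... | M | N | D = cong₂ _,_ (solve (M ∷ N ∷ D ∷ []) ℚ-ring) (solve (M ∷ N ∷ []) ℚ-ring)

  k16≡k2^4 : k 16 ≡ k 2 ^K 4
  k16≡k2^4 with ℤ→ℚ d
  ... | D = cong₂ _,_ (solve (D ∷ []) ℚ-ring) (solve (D ∷ []) ℚ-ring)

  trace-+K : ∀ x y → trace (x +K y) ≡ trace x ℚ.+ trace y
  trace-+K (a , b) (c , e) = *-distribˡ-+ (ℤ→ℚ (+ 2)) a c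

  trace-ofℤ-*K : ∀ n x → trace (ofℤ n *K x) ≡ ℤ→ℚ n ℚ.* trace x
  trace-ofℤ-*K n (a , b) with ℤ→ℚ n | ℤ→ℚ d
  ... | N | D = solve (N ∷ a ∷ b ∷ D ∷ []) ℚ-ring

  trace-cayleyHamilton : ∀ z w → trace (z *K (z *K w)) ≡ trace z ℚ.* trace (z *K w) ℚ.- norm z ℚ.* trace w
  trace-cayleyHamilton (a , b) (c , e) with ℤ→ℚ d
  ... | D = solve (a ∷ b ∷ c ∷ e ∷ D ∷ []) ℚ-ring

  norm-*K : ∀ x y → norm (x *K y) ≡ norm x ℚ.* norm y
  norm-*K (a , b) (c , e) with ℤ→ℚ d
  ... | D = solve (a ∷ b ∷ c ∷ e ∷ D ∷ []) ℚ-ring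

  norm-+K : ∀ x y → norm (x +K y) ≡ norm x ℚ.+ norm y ℚ.+ trace x ℚ.* trace y ℚ.- trace (x *K y)
  norm-+K (a , b) (c , e) with ℤ→ℚ d
  ... | D = solve (a ∷ b ∷ c ∷ e ∷ D ∷ []) ℚ-ring

  Integral-ofℤ : ∀ n → Integral (ofℤ n)
  Integral-ofℤ n = Isℤ-* (+ 2 , refl) (n , refl)
                 , Isℤ-sub (Isℤ-* (n , refl) (n , refl)) (Isℤ-* (d , refl) (Isℤ-* (+ 0 , refl) (+ 0 , refl)))

  Integral-ofℤ-*K : ∀ n x → Integral x → Integral (ofℤ n *K x)
  Integral-ofℤ-*K n x (trx , nx) =
      subst Isℤ (sym (trace-ofℤ-*K n x)) (Isℤ-* (n , refl) trx)
    , subst Isℤ (sym (norm-*K (ofℤ n) x)) (Isℤ-* (proj₂ (Integral-ofℤ n)) nx)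

  Integral-^K : ∀ z → Integral z → ∀ n → Integral (z ^K n)
  Integral-^K z (trz , nz) n = proj₁ (traces n) , norms n
    where
    norms : ∀ n → Isℤ (norm (z ^K n))
    norms zero    = proj₂ (Integral-ofℤ (+ 1))
    norms (suc n) = subst Isℤ (sym (norm-*K z (z ^K n))) (Isℤ-* nz (norms n))

    traces : ∀ n → Isℤ (trace (z ^K n)) × Isℤ (trace (z ^K suc n))
    traces zero    = proj₁ (Integral-ofℤ (+ 1)) , subst Isℤ (cong trace (sym (*K-identityʳ z))) trz
    traces (suc n) = proj₂ (traces n)
                   , subst Isℤ (sym (trace-cayleyHamilton z (z ^K n)))
                       (Isℤ-sub (Isℤ-* trz (proj₂ (traces n))) (Isℤ-* nz (proj₁ (traces n))))

  1K≢0K : ¬ 1K ≡ 0K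
  1K≢0K 1K≡0K = 1≢0 (cong proj₁ 1K≡0K)

  1K^K-*K : ∀ n x → 1K ^K n *K x ≡ x
  1K^K-*K zero    x = *K-identityˡ x
  1K^K-*K (suc n) x = trans (cong (_*K x) (*K-identityˡ (1K ^K n))) (1K^K-*K n x)

  Isomorphic-refl : ∀ E → Isomorphic E E
  Isomorphic-refl (W a₁ a₂ a₃ a₄ a₆) = 1K , 0K , 0K , 0K , 1K≢0K
    , trans (*K-identityˡ a₁) (rhs₁ a₁) , trans (1K^K-*K 2 a₂) (rhs₂ a₁ a₂)
    , trans (1K^K-*K 3 a₃) (rhs₃ a₁ a₃) , trans (1K^K-*K 4 a₄) (rhs₄ a₁ a₂ a₃ a₄)
    , trans (1K^K-*K 6 a₆) (rhs₆ a₁ a₂ a₃ a₄ a₆)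
    where
    -- Powers of u = 1 are removed by 1K^K-*K first: normalising them in the solver is prohibitively slow.
    rhs₁ : ∀ a₁ → a₁ ≡ a₁ +K k 2 *K 0K
    rhs₁ (p₁ , q₁) with ℤ→ℚ d
    ... | D = cong₂ _,_ (solve (p₁ ∷ D ∷ []) ℚ-ring) (solve (q₁ ∷ []) ℚ-ring)
    rhs₂ : ∀ a₁ a₂ → a₂ ≡ a₂ -K 0K *K a₁ +K k 3 *K 0K -K 0K *K 0K
    rhs₂ (p₁ , q₁) (p₂ , q₂) with ℤ→ℚ d
    ... | D = cong₂ _,_ (solve xs ℚ-ring) (solve xs ℚ-ring)
      where
      xs : List ℚ
      xs = p₁ ∷ q₁ ∷ p₂ ∷ q₂ ∷ D ∷ []
    rhs₃ : ∀ a₁ a₃ → a₃ ≡ a₃ +K 0K *K a₁ +K k 2 *K 0K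
    rhs₃ (p₁ , q₁) (p₃ , q₃) with ℤ→ℚ d
    ... | D = cong₂ _,_ (solve xs ℚ-ring) (solve xs ℚ-ring)
      where
      xs : List ℚ
      xs = p₁ ∷ q₁ ∷ p₃ ∷ q₃ ∷ D ∷ []
    rhs₄ : ∀ a₁ a₂ a₃ a₄ → a₄ ≡ a₄ -K 0K *K a₃ +K k 2 *K 0K *K a₂ -K (0K +K 0K *K 0K) *K a₁
                                  +K k 3 *K 0K *K 0K -K k 2 *K 0K *K 0K
    rhs₄ (p₁ , q₁) (p₂ , q₂) (p₃ , q₃) (p₄ , q₄) with ℤ→ℚ d
    ... | D = cong₂ _,_ (solve xs ℚ-ring) (solve xs ℚ-ring)
      where
      xs : List ℚ
      xs = p₁ ∷ q₁ ∷ p₂ ∷ q₂ ∷ p₃ ∷ q₃ ∷ p₄ ∷ q₄ ∷ D ∷ []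
    rhs₆ : ∀ a₁ a₂ a₃ a₄ a₆ → a₆ ≡ a₆ +K 0K *K a₄ +K 0K *K 0K *K a₂ +K 0K *K 0K *K 0K
                                     -K 0K *K a₃ -K 0K *K 0K -K 0K *K 0K *K a₁
    rhs₆ (p₁ , q₁) (p₂ , q₂) (p₃ , q₃) (p₄ , q₄) (p₆ , q₆) with ℤ→ℚ d
    ... | D = cong₂ _,_ (solve xs ℚ-ring) (solve xs ℚ-ring)
      where
      xs : List ℚ
      xs = p₁ ∷ q₁ ∷ p₂ ∷ q₂ ∷ p₃ ∷ q₃ ∷ p₄ ∷ q₄ ∷ p₆ ∷ q₆ ∷ D ∷ []

  c4-Frey : ∀ A B → Inv.c4 (Frey A B) ≡ k 16 *K B ^K 2 +K (k 16 *K A) *K (B +K A)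
  c4-Frey (a , a′) (b , b′) with ℤ→ℚ d
  ... | D = cong₂ _,_ (solve (a ∷ a′ ∷ b ∷ b′ ∷ D ∷ []) ℚ-ring) (solve (a ∷ a′ ∷ b ∷ b′ ∷ D ∷ []) ℚ-ring)

  Coprime-ofℤ : ∀ m n v → m ℤ.+ v ℤ.* n ≡ + 1 → Coprime (ofℤ m) (ofℤ n)
  Coprime-ofℤ m n v m+vn≡1 = 1K , ofℤ v , Integral-ofℤ (+ 1) , Integral-ofℤ v , (begin
    1K *K ofℤ m +K ofℤ v *K ofℤ n ≡⟨ cong (_+K ofℤ v *K ofℤ n) (*K-identityˡ (ofℤ m)) ⟩
    ofℤ m +K ofℤ v *K ofℤ n       ≡⟨ cong (ofℤ m +K_) (ofℤ-* v n) ⟨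
    ofℤ m +K ofℤ (v ℤ.* n)        ≡⟨ ofℤ-+ m (v ℤ.* n) ⟨
    ofℤ (m ℤ.+ v ℤ.* n)           ≡⟨ cong ofℤ m+vn≡1 ⟩
    1K                            ∎)
    where open ≡-Reasoning

  module AtPrime {𝔭 : K → Set} (𝔭-prime : PrimeIdeal 𝔭) where
    open PrimeIdeal 𝔭-prime

    ∈-*ʳ : ∀ x y → 𝔭 x → Integral y → 𝔭 (x *K y)
    ∈-*ʳ x y x∈𝔭 y∈𝒪 = subst 𝔭 (*K-comm y x) (*-closed y x y∈𝒪 x∈𝔭)

    ∈-neg : ∀ x → 𝔭 x → 𝔭 (-K x)
    ∈-neg x x∈𝔭 = subst 𝔭 (-1*Kx≡-Kx x) (*-closed _ x (Integral-ofℤ -[1+ 0 ]) x∈𝔭)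

    ∈-+-cancelʳ : ∀ y x → 𝔭 (y +K x) → 𝔭 x → 𝔭 y
    ∈-+-cancelʳ y x y+x∈𝔭 x∈𝔭 = subst 𝔭 (x+Ky-Ky≡x y x) (+-closed _ _ y+x∈𝔭 (∈-neg x x∈𝔭))

    ∈-^K⇒∈ : ∀ x → Integral x → ∀ n → 𝔭 (x ^K n) → 𝔭 x
    ∈-^K⇒∈ x x∈𝒪 zero    1∈𝔭   = ⊥-elim (proper 1∈𝔭)
    ∈-^K⇒∈ x x∈𝒪 (suc n) xxⁿ∈𝔭 =
      [ id , ∈-^K⇒∈ x x∈𝒪 n ]′ (prime x (x ^K n) x∈𝒪 (Integral-^K x x∈𝒪 n) xxⁿ∈𝔭)

    Coprime-∈⇒∉ : ∀ α β → Coprime α β → 𝔭 α → ¬ 𝔭 β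
    Coprime-∈⇒∉ α β (x , y , x∈𝒪 , y∈𝒪 , xα+yβ≡1) α∈𝔭 β∈𝔭 =
      proper (subst 𝔭 xα+yβ≡1 (+-closed _ _ (*-closed x α x∈𝒪 α∈𝔭) (*-closed y β y∈𝒪 β∈𝔭)))

    Integral-+-∈ : ∀ y x → Integral y → 𝔭 x → Integral (y +K x)
    Integral-+-∈ y x (try , ny) x∈𝔭 =
        subst Isℤ (sym (trace-+K y x)) (Isℤ-+ try trx)
      , subst Isℤ (sym (norm-+K y x))
          (Isℤ-sub (Isℤ-+ (Isℤ-+ ny nx) (Isℤ-* try trx)) (proj₁ (sub _ (*-closed y x (try , ny) x∈𝔭))))
      where
      trx : Isℤ (trace x)
      trx = proj₁ (sub x x∈𝔭)
      nx : Isℤ (norm x)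
      nx = proj₂ (sub x x∈𝔭)

    Integral⇒Integralᵖ : ∀ z → Integral z → Integralᵖ 𝔭 z
    Integral⇒Integralᵖ z z∈𝒪 = 1K , Integral-ofℤ (+ 1) , proper , subst Integral (sym (*K-identityˡ z)) z∈𝒪

    Integral∉⇒Unitᵖ : ∀ z → Integral z → ¬ 𝔭 z → Unitᵖ 𝔭 z
    Integral∉⇒Unitᵖ z z∈𝒪 z∉𝔭 =
      1K , Integral-ofℤ (+ 1) , proper , subst Integral (sym (*K-identityˡ z)) z∈𝒪 , z∉𝔭 ∘ subst 𝔭 (*K-identityˡ z)

    Frey-c4-unit : ∀ A B → ¬ 𝔭 (k 2) → 𝔭 A → Integral B → ¬ 𝔭 B → Unitᵖ 𝔭 (Inv.c4 (Frey A B))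
    Frey-c4-unit A B 2∉𝔭 A∈𝔭 B∈𝒪 B∉𝔭 =
      Integral∉⇒Unitᵖ _ (subst Integral (sym (c4-Frey A B)) (Integral-+-∈ 16B² rest 16B²∈𝒪 rest∈𝔭)) c4∉𝔭
      where
      16B² rest : K
      16B² = k 16 *K B ^K 2
      rest = (k 16 *K A) *K (B +K A)
      B²∈𝒪 : Integral (B ^K 2)
      B²∈𝒪 = Integral-^K B B∈𝒪 2
      16B²∈𝒪 : Integral 16B²
      16B²∈𝒪 = Integral-ofℤ-*K (+ 16) (B ^K 2) B²∈𝒪
      rest∈𝔭 : 𝔭 rest
      rest∈𝔭 = ∈-*ʳ (k 16 *K A) (B +K A) (*-closed (k 16) A (Integral-ofℤ (+ 16)) A∈𝔭) (Integral-+-∈ B A B∈𝒪 A∈𝔭)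
      16∉𝔭 : ¬ 𝔭 (k 16)
      16∉𝔭 16∈𝔭 = 2∉𝔭 (∈-^K⇒∈ (k 2) (Integral-ofℤ (+ 2)) 4 (subst 𝔭 k16≡k2^4 16∈𝔭))
      16B²∈𝔭 : 𝔭 (Inv.c4 (Frey A B)) → 𝔭 16B²
      16B²∈𝔭 c4∈𝔭 = ∈-+-cancelʳ 16B² rest (subst 𝔭 (c4-Frey A B) c4∈𝔭) rest∈𝔭
      c4∉𝔭 : ¬ 𝔭 (Inv.c4 (Frey A B))
      c4∉𝔭 c4∈𝔭 =
        [ 16∉𝔭 , B∉𝔭 ∘ ∈-^K⇒∈ B B∈𝒪 2 ]′ (prime (k 16) (B ^K 2) (Integral-ofℤ (+ 16)) B²∈𝒪 (16B²∈𝔭 c4∈𝔭))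

    Frey-semistable : ∀ A B → ¬ 𝔭 (k 2) → 𝔭 A → Integral B → ¬ 𝔭 B → SemistableAt 𝔭 (Frey A B)
    Frey-semistable A B 2∉𝔭 A∈𝔭 B∈𝒪 B∉𝔭 =
      Frey A B , Isomorphic-refl (Frey A B)
      , Integral⇒Integralᵖ 0K 0∈𝒪 , Integral⇒Integralᵖ (B -K A) (Integral-+-∈ B (-K A) B∈𝒪 (∈-neg A A∈𝔭))
      , Integral⇒Integralᵖ 0K 0∈𝒪 , Integral⇒Integralᵖ (-K (A *K B)) (sub _ (∈-neg _ (∈-*ʳ A B A∈𝔭 B∈𝒪)))
      , Integral⇒Integralᵖ 0K 0∈𝒪
      , inj₂ (Frey-c4-unit A B 2∉𝔭 A∈𝔭 B∈𝒪 B∉𝔭)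
      where
      0∈𝒪 : Integral 0K
      0∈𝒪 = Integral-ofℤ (+ 0)

mainTheorem4 : (d : ℤ) → d ∈ allowedD → (r p : ℕ) → r ≥ 1 → Prime p →
    (a b c : K) →
    Field.Integral d a → Field.Integral d b → Field.Integral d c →
    ¬ (Field._*K_ d (Field._*K_ d a b) c ≡ Field.0K d) →
    Field._+K_ d (Field._+K_ d (Field._*K_ d (Field._^K_ d (Field.ofℤ d d) r) (Field._^K_ d a p)) (Field._^K_ d b p)) (Field._^K_ d c p) ≡ Field.0K d →
    Field.Primitive d (Field._*K_ d (Field.ofℤ d d) a) b c →
    (𝔭 : K → Set) → Field.PrimeIdeal d 𝔭 → 𝔭 (Field.ofℤ d d) →
    Field.SemistableAt d 𝔭 (Field.Frey d (Field._*K_ d (Field._^K_ d (Field.ofℤ d d) r) (Field._^K_ d a p)) (Field._^K_ d b p))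
mainTheorem4 d d∈D (suc r) p (s≤s _) _ a b _ a∈𝒪 b∈𝒪 _ _ _ (da⊥b , _ , _) 𝔭 𝔭-prime d∈𝔭 =
  Frey-semistable A B 2∉𝔭 A∈𝔭 (Integral-^K b b∈𝒪 p) B∉𝔭
  where
  open Field d
  open QuadraticIntegers d
  open AtPrime 𝔭-prime
  A B : K
  A = ofℤ d ^K suc r *K a ^K p
  B = b ^K p
  dʳ⁺¹∈𝔭 : 𝔭 (ofℤ d ^K suc r)
  dʳ⁺¹∈𝔭 = ∈-*ʳ (ofℤ d) (ofℤ d ^K r) d∈𝔭 (Integral-^K (ofℤ d) (Integral-ofℤ d) r)
  A∈𝔭 : 𝔭 A
  A∈𝔭 = ∈-*ʳ (ofℤ d ^K suc r) (a ^K p) dʳ⁺¹∈𝔭 (Integral-^K a a∈𝒪 p)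
  B∉𝔭 : ¬ 𝔭 B
  B∉𝔭 = Coprime-∈⇒∉ (ofℤ d *K a) b da⊥b (∈-*ʳ (ofℤ d) a d∈𝔭 a∈𝒪) ∘ ∈-^K⇒∈ b b∈𝒪 p
  2∉𝔭 : ¬ 𝔭 (k 2)
  2∉𝔭 with All.lookup allowedD-odd d∈D
  ... | v , d+v2≡1 = Coprime-∈⇒∉ (ofℤ d) (k 2) (Coprime-ofℤ d (+ 2) v d+v2≡1) d∈𝔭
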